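{- Let $\mathcal{G}=(G,\lambda)$ be a simple temporal clique with $G=(V,E)$, and let $E^-_T$, $E^+_T$, the emitters and the collectors be as defined below (for any of the arbitrary choices allowed). Then the bidirectional fireworks cover $$S=\{\{u,v\}:(u,v)\in E^-_T\cup E^+_T\}\cup\{\{u,v\}\in E: u\text{ is an emitter and } v \text{ is a collector}\}$$ is a temporal spanner of $\mathcal{G}$.
   Context: A simple temporal clique is a pair $\mathcal{G}=(G,\lambda)$ where $G=(V,E)$ is the complete graph on a finite vertex set $V$ with $|V|\ge 2$, and $\lambda:E\to\mathbb{N}$ assigns each edge a single label such that any two distinct edges sharing an endpoint have distinct labels. A journey from $x$ to $y$ is a sequence of edges $\{u_1,u_2\},\dots,\{u_k,u_{k+1}\}$ ($k\ge1$) with $u_1=x$, $u_{k+1}=y$, the $u_i$ pairwise distinct, and strictly increasing labels. A subset $E'\subseteq E$ is a temporal spanner of $\mathcal{G}$ if for every ordered pair of distinct vertices $x,y$ there is a journey from $x$ to $y$ using only edges of $E'$. For a vertex $v$, $e^-(v)$ (resp. $e^+(v)$) denotes the edge incident to $v$ with the smallest (resp. largest) label. Forward structure: $E^-$ is the set of arcs containing, for each vertex $v$ with $e^-(v)=\{u,v\}$, the arc $(u,v)$, except that whenever $e^-(u)=e^-(v)$ only one of $(u,v),(v,u)$ is included (arbitrarily). $E^-_T$ is obtained from $E^-$: for every vertex $v$ of out-degree at least $2$ in $E^-$, with out-arcs $(v,u_1),\dots,(v,u_\ell)$ where $(v,u_\ell)$ has the largest label, for each $i<\ell$ replace $(v,u_i)$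 by $(u_i,v)$ if $u_i$ has out-degree $0$ in $E^-$, and otherwise delete $(v,u_i)$. Emitters are the vertices of out-degree $0$ in $(V,E^-_T)$. Backward structure: $E^+$ is the set of arcs containing, for each vertex $v$ with $e^+(v)=\{u,v\}$, the arc $(v,u)$, except that whenever $e^+(u)=e^+(v)$ only one of $(u,v),(v,u)$ is included (arbitrarily). $E^+_T$ is obtained from $E^+$: for every vertex $v$ of in-degree at least $2$ in $E^+$, with in-arcs $(u_1,v),\dots,(u_\ell,v)$ where $(u_\ell,v)$ has the smallest label, for each $i<\ell$ replace $(u_i,v)$ by $(v,u_i)$ if $u_i$ has in-degree $0$ in $E^+$, and otherwise delete $(u_i,v)$. Collectors are the vertices of in-degree $0$ in $(V,E^+_T)$. A vertex may be both an emitter and a collector. -}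

module Defs where

open import Data.Nat using (ℕ; _<_; _≤_)
open import Data.Fin using (Fin)
open import Data.List using (List; []; _∷_)
open import Data.List.Relation.Unary.Unique.Propositional using (Unique)
open import Data.Product using (Σ; ∃; ∃-syntax; _×_)
open import Data.Sum using (_⊎_)
open import Relation.Nullary using (¬_)
open import Relation.Binary.PropositionalEquality using (_≡_; _≢_)

-- Vertices are Fin n; the edge {u,v} (u ≢ v) of the complete graph has
-- label  lab u v  (only the values on distinct pairs matter).
-- A set of arcs / a set of edges is a relation  Fin n → Fin n → Set
-- (a set of edges is read symmetrically).

module Clique {n : ℕ} (lab : Fin n → Fin n → ℕ) where

  Rel : Set₁
  Rel = Fin n → Fin n → Set

  IsSimpleTemporalClique : Set
  IsSimpleTemporalClique =
    (∀ u v → lab u v ≡ lab v u) ×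
    (∀ u v w → u ≢ v → u ≢ w → v ≢ w → lab u v ≢ lab u w)

  IsMinEdge : Fin n → Fin n → Set
  IsMinEdge v u = u ≢ v × (∀ w → w ≢ v → w ≢ u → lab v u < lab v w)

  IsMaxEdge : Fin n → Fin n → Set
  IsMaxEdge v u = u ≢ v × (∀ w → w ≢ v → w ≢ u → lab v w < lab v u)

  -- A is a valid choice of E⁻: it contains (u,v) for every v with e⁻(v)={u,v},
  -- except that for e⁻(u)=e⁻(v) exactly one of (u,v),(v,u) is present.
  IsEMinus : Rel → Set
  IsEMinus A =
    (∀ u v → A u v → IsMinEdge v u) ×
    (∀ u v → IsMinEdge v u → A u v ⊎ A v u) ×
    (∀ u v → A u v → ¬ A v u)

  -- B is a valid choice of E⁺: it contains (v,u) for every v with e⁺(v)={u,v},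
  -- except that for e⁺(u)=e⁺(v) exactly one of (u,v),(v,u) is present.
  IsEPlus : Rel → Set
  IsEPlus B =
    (∀ v u → B v u → IsMaxEdge v u) ×
    (∀ v u → IsMaxEdge v u → B v u ⊎ B u v) ×
    (∀ u v → B u v → ¬ B v u)

  -- E⁻_T from E⁻ = A.  An out-arc (v,u) of A is "non-maximal" iff v has
  -- another out-arc in A with a larger label (then v has out-degree ≥ 2 and
  -- (v,u) is not the arc of largest label).
  NonMaxOut : Rel → Fin n → Fin n → Set
  NonMaxOut A v u = ∃[ w ] (A v w × lab v u < lab v w)

  OutDeg0 : Rel → Fin n → Set
  OutDeg0 A v = ∀ w → ¬ A v w

  EMinusT : Rel → Rel
  EMinusT A a b =
    (A a b × ¬ NonMaxOut A a b) ⊎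
    (A b a × NonMaxOut A b a × OutDeg0 A a)

  Emitter : Rel → Fin n → Set
  Emitter A v = OutDeg0 (EMinusT A) v

  NonMinIn : Rel → Fin n → Fin n → Set
  NonMinIn B u v = ∃[ w ] (B w v × lab w v < lab u v)

  InDeg0 : Rel → Fin n → Set
  InDeg0 B v = ∀ w → ¬ B w v

  EPlusT : Rel → Rel
  EPlusT B a b =
    (B a b × ¬ NonMinIn B a b) ⊎
    (B b a × NonMinIn B b a × InDeg0 B b)

  Collector : Rel → Fin n → Set
  Collector B v = InDeg0 (EPlusT B) v

  Fireworks : Rel → Rel → Rel
  Fireworks A B u v =
    u ≢ v ×
    (EMinusT A u v ⊎ EMinusT A v u ⊎ EPlusT B u v ⊎ EPlusT B v u ⊎
     (Emitter A u × Collector B v) ⊎ (Emitter A v × Collector B u))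

  -- JourneyL S x y vs ℓ : vs = x ∷ … ∷ y is the vertex sequence of a walk
  -- from x to y using edges of S with strictly increasing labels, whose
  -- first edge has label ℓ.
  data JourneyL (S : Rel) : Fin n → Fin n → List (Fin n) → ℕ → Set where
    edge : ∀ {x y} → S x y → JourneyL S x y (x ∷ y ∷ []) (lab x y)
    step : ∀ {x z y vs ℓ} → S x z → lab x z < ℓ → JourneyL S z y vs ℓ →
           JourneyL S x y (x ∷ vs) (lab x z)

  Journey : Rel → Fin n → Fin n → Set
  Journey S x y = ∃[ vs ] ∃[ ℓ ] (JourneyL S x y vs ℓ × Unique vs)

  IsTemporalSpanner : Rel → Set
  IsTemporalSpanner S = ∀ x y → x ≢ y → Journey S x y

-- Following E⁻_T forward from x, labels strictly increase, so the walk ends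
-- at an emitter e; the arc entering e is e's minimum edge e⁻(e).  Dually,
-- following E⁺_T backward from y ends at a collector c, left through its
-- maximum edge e⁺(c).  Every edge at e is no earlier than e⁻(e) and every
-- edge at c is no later than e⁺(c), so x ⇝ e —{e,c}— c ⇝ y is a temporal
-- walk; when two consecutive edges of it coincide (or e = c) the shared
-- edge is skipped.  Finally every temporal walk shortens to a journey.
module Submission where

open import Defs
open import Data.Nat using (ℕ; zero; suc; _≤_; _<_; _<?_; _∸_; _⊔_; z≤n; s≤s)
open import Data.Nat.Properties
  using ( ≤-refl; ≤-trans; <-trans; <-≤-trans; ≤-<-trans; <⇒≤; ≮⇒≥; n≤1+n
        ; m≤m⊔n; m≤n⊔m; ∸-monoʳ-<)
open import Data.Nat.Induction using (<-wellFounded)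
open import Data.Fin using (Fin; _≟_)
open import Data.Fin.Properties using (any?; all?)
open import Data.List.Membership.Propositional using (_∈_)
open import Data.List.Relation.Unary.Any using (here; there)
open import Data.List.Relation.Unary.All using ([]; _∷_)
open import Data.List.Relation.Unary.All.Properties using (¬Any⇒All¬)
open import Data.List.Relation.Unary.AllPairs using ([]; _∷_)
open import Data.List.Relation.Unary.Unique.Propositional using (Unique)
open import Data.Product using (∃-syntax; _×_; _,_; proj₁; proj₂)
open import Data.Sum using (_⊎_; inj₁; inj₂)
open import Data.Empty using (⊥-elim)
open import Function using (_∘_)
open import Induction.WellFounded using (Acc; acc)
open import Relation.Nullary using (¬_; Dec; yes; no)
open import Relation.Nullary.Decidable using (_×-dec_; _⊎-dec_; _→-dec_; ¬?)
open import Relation.Binary.Definitions using (Decidable)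
open import Relation.Binary.PropositionalEquality using (_≡_; _≢_; refl; subst; ≢-sym)

finite-bounded : ∀ m (f : Fin m → ℕ) → ∃[ b ] (∀ i → f i < b)
finite-bounded zero    f = 0 , λ ()
finite-bounded (suc m) f with finite-bounded m (f ∘ Fin.suc)
... | b , f<b = suc (f Fin.zero) ⊔ b , λ where
  Fin.zero    → m≤m⊔n (suc (f Fin.zero)) b
  (Fin.suc i) → <-≤-trans (f<b i) (m≤n⊔m (suc (f Fin.zero)) b)

labels-bounded : ∀ {n} (lab : Fin n → Fin n → ℕ) → ∃[ H ] (∀ u v → lab u v < H)
labels-bounded {n} lab with finite-bounded n (λ u → proj₁ (finite-bounded n (lab u)))
... | H , rows<H = H , λ u v → <-trans (proj₂ (finite-bounded n (lab u)) v) (rows<H u)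

module _ {X : Set} {P : X → Set} where

  no-infinite-descent : (f : X → ℕ) → (∀ {x} → P x → ¬ ¬ (∃[ y ] (P y × f y < f x))) →
                        ∀ x → ¬ P x
  no-infinite-descent f smaller x = go x (<-wellFounded (f x))
    where
    go : ∀ x → Acc _<_ (f x) → ¬ P x
    go x (acc rs) px = smaller px λ (y , py , fy<fx) → go y (rs fy<fx) py

  no-bounded-ascent : ∀ {H} (f : X → ℕ) → (∀ x → f x < H) →
                      (∀ {x} → P x → ¬ ¬ (∃[ y ] (P y × f x < f y))) → ∀ x → ¬ P x
  no-bounded-ascent {H} f f<H larger =
    no-infinite-descent (λ x → H ∸ f x)
      λ px ¬smaller → larger px λ (y , py , fx<fy) →
        ¬smaller (y , py , ∸-monoʳ-< fx<fy (<⇒≤ (f<H y)))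

module _ {n : ℕ} (lab : Fin n → Fin n → ℕ) where
  open Clique lab

  isMinEdge? : Decidable IsMinEdge
  isMinEdge? v u = ¬? (u ≟ v) ×-dec
    all? (λ w → ¬? (w ≟ v) →-dec ¬? (w ≟ u) →-dec lab v u <? lab v w)

  isMaxEdge? : Decidable IsMaxEdge
  isMaxEdge? v u = ¬? (u ≟ v) ×-dec
    all? (λ w → ¬? (w ≟ v) →-dec ¬? (w ≟ u) →-dec lab v w <? lab v u)

module TemporalWalks {n : ℕ} (lab : Fin n → Fin n → ℕ) (S : Fin n → Fin n → Set) where
  open Clique lab using (JourneyL; edge; step; Journey)
  open import Data.List.Membership.DecPropositional (_≟_ {n}) using (_∈?_)

  -- Walk lo x y hi: a walk along S with strictly increasing labels, all in [lo, hi).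
  data Walk : ℕ → Fin n → Fin n → ℕ → Set where
    nil  : ∀ {lo x hi} → lo ≤ hi → Walk lo x x hi
    cons : ∀ {lo x z y hi} → S x z → lo ≤ lab x z → Walk (suc (lab x z)) z y hi → Walk lo x y hi

  weaken : ∀ {lo lo′ x y hi} → lo ≤ lo′ → Walk lo′ x y hi → Walk lo x y hi
  weaken lo≤lo′ (nil lo′≤hi)   = nil (≤-trans lo≤lo′ lo′≤hi)
  weaken lo≤lo′ (cons s lo′≤ w) = cons s (≤-trans lo≤lo′ lo′≤) w

  infixr 5 _++_
  _++_ : ∀ {lo x z y t hi} → Walk lo x z t → Walk t z y hi → Walk lo x y hi
  nil lo≤t     ++ w′ = weaken lo≤t w′
  cons s lo≤ w ++ w′ = cons s lo≤ (w ++ w′)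

  JourneyFrom : ℕ → Fin n → Fin n → Set
  JourneyFrom lo x y = ∃[ vs ] ∃[ ℓ ] (lo ≤ ℓ × JourneyL S x y vs ℓ × Unique vs)

  journey-suffix : ∀ {x z y vs ℓ} → JourneyL S z y vs ℓ → Unique vs → x ∈ vs → x ≢ y →
                   JourneyFrom ℓ x y
  journey-suffix j@(edge _)        u        (here refl)         _   = _ , _ , ≤-refl , j , u
  journey-suffix j@(step _ _ _)    u        (here refl)         _   = _ , _ , ≤-refl , j , u
  journey-suffix (edge _)          _        (there (here refl)) x≢y = ⊥-elim (x≢y refl)
  journey-suffix (step _ ℓ<ℓ′ j)   (_ ∷ u)  (there x∈vs)        x≢y
    with journey-suffix j u x∈vs x≢y
  ... | vs′ , ℓ″ , ℓ′≤ℓ″ , j′ , u′ =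
          vs′ , ℓ″ , ≤-trans (<⇒≤ ℓ<ℓ′) ℓ′≤ℓ″ , j′ , u′

  -- A repeated vertex is removed by restarting from its later occurrence.
  walk⇒journeyFrom : ∀ {lo x y hi} → Walk lo x y hi → x ≢ y → JourneyFrom lo x y
  walk⇒journeyFrom (nil _) x≢y = ⊥-elim (x≢y refl)
  walk⇒journeyFrom {x = x} {y} (cons {z = z} xz lo≤ w) x≢y with z ≟ y
  ... | yes refl = _ , _ , lo≤ , edge xz , (x≢y ∷ []) ∷ [] ∷ []
  ... | no z≢y with walk⇒journeyFrom w z≢y
  ...   | vs , ℓ , lab<ℓ , j , u with x ∈? vs
  ...     | no x∉vs = _ , _ , lo≤ , step xz lab<ℓ j , ¬Any⇒All¬ vs x∉vs ∷ u
  ...     | yes x∈vs with journey-suffix j u x∈vs x≢y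
  ...       | vs′ , ℓ′ , ℓ≤ℓ′ , j′ , u′ =
                vs′ , ℓ′ , ≤-trans lo≤ (≤-trans (n≤1+n _) (≤-trans lab<ℓ ℓ≤ℓ′)) , j′ , u′

  walk⇒journey : ∀ {lo x y hi} → Walk lo x y hi → x ≢ y → Journey S x y
  walk⇒journey w x≢y with walk⇒journeyFrom w x≢y
  ... | vs , ℓ , _ , j , u = vs , ℓ , j , u

module Routing {n : ℕ} (lab : Fin n → Fin n → ℕ) (lab-sym : ∀ u v → lab u v ≡ lab v u)
               (H : ℕ) (lab<H : ∀ u v → lab u v < H) (S : Fin n → Fin n → Set) where
  open Clique lab using (IsMinEdge; IsMaxEdge)
  open TemporalWalks lab S public

  min-edge-first : ∀ {e p w} → IsMinEdge e p → w ≢ e → w ≢ p → lab p e < lab e w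
  min-edge-first {e} {p} {w} (_ , least) w≢e w≢p =
    subst (_< lab e w) (lab-sym e p) (least w w≢e w≢p)

  max-edge-last : ∀ {c q w} → IsMaxEdge c q → w ≢ c → w ≢ q → lab w c < lab c q
  max-edge-last {c} {q} {w} (_ , greatest) w≢c w≢q =
    subst (_< lab c q) (lab-sym c w) (greatest w w≢c w≢q)

  data EntryByMin : ℕ → Fin n → Fin n → Set where
    start : ∀ {lo x} → EntryByMin lo x x
    enter : ∀ {lo x p e} → Walk lo x p (lab p e) → S p e → IsMinEdge e p → EntryByMin lo x e

  data ExitByMax : Fin n → Fin n → ℕ → Set where
    stop  : ∀ {y hi} → ExitByMax y y hi
    leave : ∀ {c q y hi} → S c q → IsMaxEdge c q → Walk (suc (lab c q)) q y hi → ExitByMax c y hi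

  entry-before-edge : ∀ {x e c} → EntryByMin 0 x e → c ≢ e →
                      Walk 0 x c (lab e c) ⊎ Walk 0 x e (lab e c)
  entry-before-edge start _ = inj₂ (nil z≤n)
  entry-before-edge {c = c} (enter {p = p} {e} x⇝p pe min) c≢e with p ≟ c
  ... | yes refl = inj₁ (subst (Walk 0 _ p) (lab-sym p e) x⇝p)
  ... | no p≢c   = inj₂ (x⇝p ++ cons pe ≤-refl (nil (min-edge-first min c≢e (≢-sym p≢c))))

  exit-after-edge : ∀ {c y e} → ExitByMax c y H → e ≢ c →
                    Walk (suc (lab e c)) e y H ⊎ Walk (suc (lab e c)) c y H
  exit-after-edge {e = e} stop _ = inj₂ (nil (lab<H e _))
  exit-after-edge {e = e} (leave {c} {q} cq max q⇝y) e≢c with q ≟ e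
  ... | yes refl = inj₁ (subst (λ t → Walk (suc t) q _ H) (lab-sym c q) q⇝y)
  ... | no q≢e   = inj₂ (cons cq (max-edge-last max e≢c (≢-sym q≢e)) q⇝y)

  bridge : ∀ {lo x a b y t hi} → Walk lo x a t → S a b → lab a b ≡ t →
           Walk (suc t) b y hi → Walk lo x y hi
  bridge x⇝a ab refl b⇝y = x⇝a ++ cons ab ≤-refl b⇝y

  through-edge : ∀ {x e c y} → EntryByMin 0 x e → ExitByMax c y H →
                 S e c → S c e → e ≢ c → Walk 0 x y H
  through-edge {e = e} {c} entry exit ec ce e≢c
    with entry-before-edge entry (≢-sym e≢c) | exit-after-edge exit e≢c
  ... | inj₁ x⇝c | inj₁ e⇝y = bridge x⇝c ce (lab-sym c e) e⇝y
  ... | inj₁ x⇝c | inj₂ c⇝y = x⇝c ++ weaken (n≤1+n _) c⇝y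
  ... | inj₂ x⇝e | inj₁ e⇝y = x⇝e ++ weaken (n≤1+n _) e⇝y
  ... | inj₂ x⇝e | inj₂ c⇝y = bridge x⇝e ec refl c⇝y

  through-vertex : ∀ {x e y} → EntryByMin 0 x e → ExitByMax e y H → x ≢ y → Walk 0 x y H
  through-vertex entry (leave eq max q⇝y) _ with entry-before-edge entry (proj₁ max)
  ... | inj₁ x⇝q = x⇝q ++ weaken (n≤1+n _) q⇝y
  ... | inj₂ x⇝e = bridge x⇝e eq refl q⇝y
  through-vertex (enter x⇝p pe _) stop _ = x⇝p ++ cons pe ≤-refl (nil (lab<H _ _))
  through-vertex start stop x≢x = ⊥-elim (x≢x refl)

module FireworksCover {n : ℕ} (lab : Fin n → Fin n → ℕ) (lab-sym : ∀ u v → lab u v ≡ lab v u)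
  (H : ℕ) (lab<H : ∀ u v → lab u v < H) (A B : Fin n → Fin n → Set)
  (A-min : ∀ u v → A u v → Clique.IsMinEdge lab v u)
  (min-A : ∀ u v → Clique.IsMinEdge lab v u → A u v ⊎ A v u)
  (A-asym : ∀ u v → A u v → ¬ A v u)
  (B-max : ∀ v u → B v u → Clique.IsMaxEdge lab v u)
  (max-B : ∀ v u → Clique.IsMaxEdge lab v u → B v u ⊎ B u v)
  (B-asym : ∀ u v → B u v → ¬ B v u) where
  open Clique lab
  open Routing lab lab-sym H lab<H (Fireworks A B)

  A? : Decidable A
  A? u v with isMinEdge? lab v u
  ... | no ¬min = no (¬min ∘ A-min u v)
  ... | yes min with min-A u v min
  ...   | inj₁ uv = yes uv
  ...   | inj₂ vu = no (A-asym v u vu)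

  B? : Decidable B
  B? v u with isMaxEdge? lab v u
  ... | no ¬max = no (¬max ∘ B-max v u)
  ... | yes max with max-B v u max
  ...   | inj₁ vu = yes vu
  ...   | inj₂ uv = no (B-asym u v uv)

  EMinusT? : Decidable (EMinusT A)
  EMinusT? a b = (A? a b ×-dec ¬? (nonMaxOut? a b)) ⊎-dec (A? b a ×-dec nonMaxOut? b a ×-dec outDeg0? a)
    where
    nonMaxOut? : Decidable (NonMaxOut A)
    nonMaxOut? v u = any? λ w → A? v w ×-dec lab v u <? lab v w
    outDeg0? : ∀ v → Dec (OutDeg0 A v)
    outDeg0? v = all? λ w → ¬? (A? v w)

  EPlusT? : Decidable (EPlusT B)
  EPlusT? a b = (B? a b ×-dec ¬? (nonMinIn? a b)) ⊎-dec (B? b a ×-dec nonMinIn? b a ×-dec inDeg0? b)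
    where
    nonMinIn? : Decidable (NonMinIn B)
    nonMinIn? u v = any? λ w → B? w v ×-dec lab w v <? lab u v
    inDeg0? : ∀ v → Dec (InDeg0 B v)
    inDeg0? v = all? λ w → ¬? (B? w v)

  EMinusT-distinct : ∀ {a b} → EMinusT A a b → a ≢ b
  EMinusT-distinct (inj₁ (ab , _)) = proj₁ (A-min _ _ ab)
  EMinusT-distinct (inj₂ (ba , _)) = ≢-sym (proj₁ (A-min _ _ ba))

  EPlusT-distinct : ∀ {a b} → EPlusT B a b → a ≢ b
  EPlusT-distinct (inj₁ (ab , _)) = ≢-sym (proj₁ (B-max _ _ ab))
  EPlusT-distinct (inj₂ (ba , _)) = proj₁ (B-max _ _ ba)

  EMinusT⊆cover : ∀ {a b} → EMinusT A a b → Fireworks A B a b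
  EMinusT⊆cover ab = EMinusT-distinct ab , inj₁ ab

  EPlusT⊆cover : ∀ {a b} → EPlusT B a b → Fireworks A B a b
  EPlusT⊆cover ab = EPlusT-distinct ab , inj₂ (inj₂ (inj₁ ab))

  emitter-collector∈cover : ∀ {e c} → Emitter A e → Collector B c → e ≢ c → Fireworks A B e c
  emitter-collector∈cover em col e≢c = e≢c , inj₂ (inj₂ (inj₂ (inj₂ (inj₁ (em , col)))))

  collector-emitter∈cover : ∀ {e c} → Emitter A e → Collector B c → e ≢ c → Fireworks A B c e
  collector-emitter∈cover em col e≢c = ≢-sym e≢c , inj₂ (inj₂ (inj₂ (inj₂ (inj₂ (em , col)))))

  EMinusT-increasing : ∀ {a b c} → EMinusT A a b → EMinusT A b c → lab a b < lab b c
  EMinusT-increasing {a} {b} {c} (inj₁ (ab , _)) bc with c ≟ a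
  ... | no c≢a = min-edge-first (A-min a b ab) (≢-sym (EMinusT-distinct bc)) c≢a
  EMinusT-increasing (inj₁ (ab , _))      (inj₁ (ba , _))          | yes refl = ⊥-elim (A-asym _ _ ab ba)
  EMinusT-increasing (inj₁ (_ , ¬nonMax)) (inj₂ (_ , nonMax , _)) | yes refl = ⊥-elim (¬nonMax nonMax)
  EMinusT-increasing {a} {b} {c} (inj₂ (ba , (w , bw , ba<bw) , _)) (inj₁ (_ , ¬nonMax)) =
    subst (_< lab b c) (lab-sym b a) (<-≤-trans ba<bw (≮⇒≥ λ bc<bw → ¬nonMax (w , bw , bc<bw)))
  EMinusT-increasing (inj₂ (ba , _)) (inj₂ (_ , _ , outDeg0)) = ⊥-elim (outDeg0 _ ba)

  EPlusT-increasing : ∀ {a b c} → EPlusT B a b → EPlusT B b c → lab a b < lab b c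
  EPlusT-increasing {a} {b} {c} ab (inj₁ (bc , _)) with a ≟ c
  ... | no a≢c = max-edge-last (B-max b c bc) (EPlusT-distinct ab) a≢c
  EPlusT-increasing (inj₁ (cb , _))          (inj₁ (bc , _))      | yes refl = ⊥-elim (B-asym _ _ bc cb)
  EPlusT-increasing (inj₂ (_ , nonMin , _))  (inj₁ (_ , ¬nonMin)) | yes refl = ⊥-elim (¬nonMin nonMin)
  EPlusT-increasing {a} {b} {c} (inj₁ (_ , ¬nonMin)) (inj₂ (_ , (w , wb , wb<cb) , _)) =
    subst (lab a b <_) (lab-sym c b) (≤-<-trans (≮⇒≥ λ wb<ab → ¬nonMin (w , wb , wb<ab)) wb<cb)
  EPlusT-increasing (inj₂ (_ , _ , inDeg0)) (inj₂ (_ , (w , wb , _) , _)) = ⊥-elim (inDeg0 w wb)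

  -- An out-arc of e of maximal label would survive in E⁻_T.
  emitter-has-no-out-arc : ∀ {e} → Emitter A e → ∀ w → ¬ A e w
  emitter-has-no-out-arc {e} em =
    no-bounded-ascent (lab e) (lab<H e) λ ew ¬nonMax → em _ (inj₁ (ew , ¬nonMax))

  collector-has-no-in-arc : ∀ {c} → Collector B c → ∀ w → ¬ B w c
  collector-has-no-in-arc {c} col =
    no-infinite-descent (λ w → lab w c) λ wc ¬nonMin → col _ (inj₁ (wc , ¬nonMin))

  emitter-entered-by-min : ∀ {p e} → EMinusT A p e → Emitter A e → IsMinEdge e p
  emitter-entered-by-min (inj₁ (pe , _)) _  = A-min _ _ pe
  emitter-entered-by-min (inj₂ (ep , _)) em = ⊥-elim (emitter-has-no-out-arc em _ ep)

  collector-left-by-max : ∀ {c q} → EPlusT B c q → Collector B c → IsMaxEdge c q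
  collector-left-by-max (inj₁ (cq , _)) _   = B-max _ _ cq
  collector-left-by-max (inj₂ (qc , _)) col = ⊥-elim (collector-has-no-in-arc col _ qc)

  reach-emitter : ∀ lo x → Acc _<_ (H ∸ lo) → (∀ w → EMinusT A x w → lo ≤ lab x w) →
                  ∃[ e ] (Emitter A e × EntryByMin lo x e)
  reach-emitter lo x (acc rs) lo≤out with any? (EMinusT? x)
  ... | no ¬out = x , (λ w xw → ¬out (w , xw)) , start
  ... | yes (w , xw)
    with reach-emitter (suc (lab x w)) w (rs (∸-monoʳ-< (s≤s (lo≤out w xw)) (lab<H x w)))
                       (λ _ → EMinusT-increasing xw)
  ...   | e , em , start =
          e , em , enter (nil (lo≤out w xw)) (EMinusT⊆cover xw) (emitter-entered-by-min xw em)
  ...   | e , em , enter w⇝p pe min =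
          e , em , enter (cons (EMinusT⊆cover xw) (lo≤out w xw) w⇝p) pe min

  reach-collector : ∀ y hi → Acc _<_ hi → (∀ w → EPlusT B w y → lab w y < hi) →
                    ∃[ c ] (Collector B c × ExitByMax c y hi)
  reach-collector y hi (acc rs) in<hi with any? (λ w → EPlusT? w y)
  ... | no ¬in = y , (λ w wy → ¬in (w , wy)) , stop
  ... | yes (w , wy)
    with reach-collector w (lab w y) (rs (in<hi w wy)) (λ _ vw → EPlusT-increasing vw wy)
  ...   | c , col , stop =
          c , col , leave (EPlusT⊆cover wy) (collector-left-by-max wy col) (nil (in<hi w wy))
  ...   | c , col , leave cq max q⇝w =
          c , col , leave cq max (q⇝w ++ cons (EPlusT⊆cover wy) ≤-refl (nil (in<hi w wy)))

  spanner : IsTemporalSpanner (Fireworks A B)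
  spanner x y x≢y
    with reach-emitter 0 x (<-wellFounded (H ∸ 0)) (λ _ _ → z≤n)
       | reach-collector y H (<-wellFounded H) (λ w _ → lab<H w y)
  ... | e , em , entry | c , col , exit with e ≟ c
  ...   | yes refl = walk⇒journey (through-vertex entry exit x≢y) x≢y
  ...   | no e≢c   = walk⇒journey (through-edge entry exit (emitter-collector∈cover em col e≢c)
                                     (collector-emitter∈cover em col e≢c) e≢c) x≢y

theorem6 : (n : ℕ) → 2 ≤ n → (lab : Fin n → Fin n → ℕ) →
    Clique.IsSimpleTemporalClique lab →
    (A B : Fin n → Fin n → Set) →
    Clique.IsEMinus lab A → Clique.IsEPlus lab B →
    Clique.IsTemporalSpanner lab (Clique.Fireworks lab A B)
theorem6 n _ lab (lab-sym , _) A B (A-min , min-A , A-asym) (B-max , max-B , B-asym)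
  with labels-bounded lab
... | H , lab<H =
  FireworksCover.spanner lab lab-sym H lab<H A B A-min min-A A-asym B-max max-B B-asym
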